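{- Let $T$ be a monad on $\mathbf{Set}$, $\mathcal{D}$ a complete category, $\bar\Omega=(\Omega_{\mathcal{D}},\tau)$ a $\mathcal{D}$-relative $T$-algebra, $R$ a monad on $\mathcal{E}\mathcal{M}(T)$, and $\rho\colon R\to S$ a monad map, where $S=[[-,\bar\Omega]_T,\bar\Omega]_{\mathcal{D}}$ is the monad on $\mathcal{E}\mathcal{M}(T)$ arising from the adjunction $[-,\bar\Omega]_T\dashv[-,\bar\Omega]_{\mathcal{D}}$. Define $\mathbb{P}^\rho\colon\mathcal{K}\ell(R)\to\mathcal{D}^{\mathrm{op}}$ by $\mathbb{P}^\rho(A_a)=[A_a,\bar\Omega]_T$ and, for $f\colon A_a\to RB_b$ in $\mathcal{E}\mathcal{M}(T)$, $\mathbb{P}^\rho(f)=f^*\circ\rho^\sharp\colon[B_b,\bar\Omega]_T\to[RB_b,\bar\Omega]_T\to[A_a,\bar\Omega]_T$, where $\rho^\sharp$ is the transpose of $\rho_{B_b}\colon RB_b\to[[B_b,\bar\Omega]_T,\bar\Omega]_{\mathcal{D}}$ under the adjunction and $f^*=[f,\bar\Omega]_T$. Let $\mathbb{P}^{(\tau,\rho)}=\mathbb{P}^\rho\circ K\colon\mathcal{K}\ell(R\star T)\to\mathcal{D}^{\mathrm{op}}$, where $R\star T=URF$ for the free–forgetful adjunction $F\dashv U\colon\mathcal{E}\mathcal{M}(T)\to\mathbf{Set}$ and $K\colon\mathcal{K}\ell(R\star T)\to\mathcal{K}\ell(R)$ is the comparison functor ($X\mapsto FX$, a function $X\to URFY$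 sent to its transpose $FX\to RFY$). Let $X,Y$ be sets. If the map $U\rho_{FY}\colon URFY\to U[[FY,\bar\Omega]_T,\bar\Omega]_{\mathcal{D}}\cong\mathcal{D}(\Omega_{\mathcal{D}}^Y,\Omega_{\mathcal{D}})$ is surjective (resp. injective), then the action $\mathbb{P}^{(\tau,\rho)}_{XY}\colon\mathbf{Set}(X,URFY)\to\mathcal{D}(\Omega_{\mathcal{D}}^Y,\Omega_{\mathcal{D}}^X)$ is surjective (resp. injective), using $[FZ,\bar\Omega]_T\cong\Omega_{\mathcal{D}}^Z$.
   Context: For $A\in\mathcal{D}$ and a set $X$, $A^X$ is the $X$-fold product with projections $\pi_x$; for $g\colon X\to Y$, $g^*\colon A^Y\to A^X$ satisfies $\pi_x\circ g^*=\pi_{g(x)}$. The monad $\mathcal{D}(A^{(-)},A)$ on $\mathbf{Set}$ sends $g$ to $k\mapsto k\circ g^*$, with unit $x\mapsto\pi_x$ and multiplication $\Xi\mapsto\Xi\circ\langle\varphi\rangle_{\varphi\in\mathcal{D}(A^X,A)}$. A $\mathcal{D}$-relative $T$-algebra is $(A,\alpha)$ with $\alpha\colon T\to\mathcal{D}(A^{(-)},A)$ a monad map; $\alpha^\sharp_X=\langle\alpha_X(t)\rangle_{t\in TX}\colon A^X\to A^{TX}$. The functor $[-,\bar\Omega]_{\mathcal{D}}\colon\mathcal{D}^{\mathrm{op}}\to\mathcal{E}\mathcal{M}(T)$ sends $D$ to the set $\mathcal{D}(D,\Omega_{\mathcal{D}})$ with $T$-algebra structure $(\mathrm{id}^\sharp)^*\circ\tau_{\mathcal{D}(D,\Omega_{\mathcal{D}})}$,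 where $\mathrm{id}^\sharp=\langle k\rangle_{k}\colon D\to\Omega_{\mathcal{D}}^{\mathcal{D}(D,\Omega_{\mathcal{D}})}$, and a morphism to precomposition. The functor $[-,\bar\Omega]_T\colon\mathcal{E}\mathcal{M}(T)\to\mathcal{D}^{\mathrm{op}}$ sends a $T$-algebra $A_a=(A,a)$ to the equalizer of $a^*,\tau^\sharp_A\colon\Omega_{\mathcal{D}}^A\rightrightarrows\Omega_{\mathcal{D}}^{TA}$ and a morphism $f$ to the induced map of equalizers from $f^*$; $[-,\bar\Omega]_T$ is left adjoint to $[-,\bar\Omega]_{\mathcal{D}}$. -}

module Defs where

open import Level using (Level; _⊔_) renaming (zero to lzero; suc to lsuc)
open import Relation.Binary.PropositionalEquality
open import Data.Product using (Σ; _,_; _×_)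

Surjective : {A B : Set} → (A → B) → Set
Surjective {A} {B} f = (b : B) → Σ A (λ a → f a ≡ b)

Injective : {A B : Set} → (A → A → Set) → (A → B) → Set
Injective _≈_ f = ∀ a a′ → f a ≡ f a′ → a ≈ a′

-- pointwise (extensional) equality of functions: equality in Set(X , Y)
_≐_ : {X Y : Set} → (X → Y) → (X → Y) → Set
f ≐ g = ∀ x → f x ≡ g x

record MonadSet : Set₁ where
  field
    T      : Set → Set
    fmap   : ∀ {X Y} → (X → Y) → T X → T Y
    fmap-cong : ∀ {X Y} {f g : X → Y} → f ≐ g → fmap f ≐ fmap g
    fmap-id   : ∀ {X} (t : T X) → fmap (λ x → x) t ≡ t
    fmap-∘    : ∀ {X Y Z} (g : Y → Z) (f : X → Y) (t : T X) →
                fmap (λ x → g (f x)) t ≡ fmap g (fmap f t)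
    η      : ∀ {X} → X → T X
    μ      : ∀ {X} → T (T X) → T X
    η-nat  : ∀ {X Y} (f : X → Y) (x : X) → fmap f (η x) ≡ η (f x)
    μ-nat  : ∀ {X Y} (f : X → Y) (t : T (T X)) → fmap f (μ t) ≡ μ (fmap (fmap f) t)
    μ-η    : ∀ {X} (t : T X) → μ (η t) ≡ t
    μ-Tη   : ∀ {X} (t : T X) → μ (fmap η t) ≡ t
    μ-μ    : ∀ {X} (t : T (T (T X))) → μ (μ t) ≡ μ (fmap μ t)

record Category (o : Level) : Set (lsuc o) where
  infixr 9 _∘_
  field
    Obj   : Set o
    Hom   : Obj → Obj → Set
    id    : ∀ {A} → Hom A A
    _∘_   : ∀ {A B C} → Hom B C → Hom A B → Hom A C
    idˡ   : ∀ {A B} (f : Hom A B) → id ∘ f ≡ f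
    idʳ   : ∀ {A B} (f : Hom A B) → f ∘ id ≡ f
    assoc : ∀ {A B C D} {f : Hom A B} {g : Hom B C} {h : Hom C D} →
            (h ∘ g) ∘ f ≡ h ∘ (g ∘ f)

module _ {o : Level} (𝒟 : Category o) where
  open Category 𝒟

  record Product {I : Set} (A : I → Obj) : Set o where
    field
      Π      : Obj
      π      : (i : I) → Hom Π (A i)
      ⟨_⟩    : ∀ {D} → ((i : I) → Hom D (A i)) → Hom D Π
      π-⟨⟩   : ∀ {D} (f : (i : I) → Hom D (A i)) (i : I) → π i ∘ ⟨ f ⟩ ≡ f i
      ⟨⟩-unique : ∀ {D} (f : (i : I) → Hom D (A i)) (g : Hom D Π) →
                  ((i : I) → π i ∘ g ≡ f i) → g ≡ ⟨ f ⟩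

  record Equalizer {A B : Obj} (f g : Hom A B) : Set o where
    field
      E     : Obj
      e     : Hom E A
      e-eq  : f ∘ e ≡ g ∘ e
      lift  : ∀ {D} (h : Hom D A) → f ∘ h ≡ g ∘ h → Hom D E
      e-lift : ∀ {D} (h : Hom D A) (p : f ∘ h ≡ g ∘ h) → e ∘ lift h p ≡ h
      lift-unique : ∀ {D} (h : Hom D A) (p : f ∘ h ≡ g ∘ h) (k : Hom D E) →
                    e ∘ k ≡ h → k ≡ lift h p

  record Complete : Set (lsuc lzero ⊔ o) where
    field
      product   : {I : Set} (A : I → Obj) → Product A
      equalizer : ∀ {A B} (f g : Hom A B) → Equalizer f g

module EM (𝕋 : MonadSet) where
  open MonadSet 𝕋

  record Alg : Set₁ where
    field
      Car   : Set
      str   : T Car → Car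
      str-η : ∀ x → str (η x) ≡ x
      str-μ : ∀ t → str (μ t) ≡ str (fmap str t)
  open Alg public

  record AlgHom (A B : Alg) : Set where
    field
      fun : Car A → Car B
      hom : ∀ t → fun (str A t) ≡ str B (fmap fun t)
  open AlgHom public

  infix 4 _≈ₕ_
  _≈ₕ_ : ∀ {A B} → AlgHom A B → AlgHom A B → Set
  f ≈ₕ g = fun f ≐ fun g

  idₕ : ∀ {A} → AlgHom A A
  idₕ {A} = record { fun = λ x → x ; hom = λ t → sym (cong (str A) (fmap-id t)) }

  infixr 9 _∘ₕ_
  _∘ₕ_ : ∀ {A B C} → AlgHom B C → AlgHom A B → AlgHom A C
  _∘ₕ_ {A} {B} {C} g f = record
    { fun = λ x → fun g (fun f x)
    ; hom = λ t → trans (cong (fun g) (hom f t))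
                 (trans (hom g (fmap (fun f) t))
                        (cong (str C) (sym (fmap-∘ (fun g) (fun f) t)))) }

  Free : Set → Alg
  Free X = record { Car = T X ; str = μ ; str-η = μ-η ; str-μ = μ-μ }

  record MonadEM : Set₁ where
    field
      R₀     : Alg → Alg
      R₁     : ∀ {A B} → AlgHom A B → AlgHom (R₀ A) (R₀ B)
      R₁-cong : ∀ {A B} {f g : AlgHom A B} → f ≈ₕ g → R₁ f ≈ₕ R₁ g
      R₁-id  : ∀ {A} → R₁ (idₕ {A}) ≈ₕ idₕ
      R₁-∘   : ∀ {A B C} (g : AlgHom B C) (f : AlgHom A B) → R₁ (g ∘ₕ f) ≈ₕ R₁ g ∘ₕ R₁ f
      ηᴿ     : ∀ A → AlgHom A (R₀ A)
      μᴿ     : ∀ A → AlgHom (R₀ (R₀ A)) (R₀ A)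
      ηᴿ-nat : ∀ {A B} (f : AlgHom A B) → R₁ f ∘ₕ ηᴿ A ≈ₕ ηᴿ B ∘ₕ f
      μᴿ-nat : ∀ {A B} (f : AlgHom A B) → R₁ f ∘ₕ μᴿ A ≈ₕ μᴿ B ∘ₕ R₁ (R₁ f)
      μᴿ-ηᴿ  : ∀ A → μᴿ A ∘ₕ ηᴿ (R₀ A) ≈ₕ idₕ
      μᴿ-Rηᴿ : ∀ A → μᴿ A ∘ₕ R₁ (ηᴿ A) ≈ₕ idₕ
      μᴿ-μᴿ  : ∀ A → μᴿ A ∘ₕ μᴿ (R₀ A) ≈ₕ μᴿ A ∘ₕ R₁ (μᴿ A)

  -- comparison functor K : Kl(R ⋆ T) → Kl(R) on morphisms
  -- (a function X → U R F Y is sent to its transpose F X → R F Y)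
  K : (R : MonadEM) {X Y : Set} →
      (X → Car (MonadEM.R₀ R (Free Y))) → AlgHom (Free X) (MonadEM.R₀ R (Free Y))
  K R {X} {Y} f = record
    { fun = λ t → str RFY (fmap f t)
    ; hom = λ t → trans (cong (str RFY) (μ-nat f t))
              (trans (str-μ RFY (fmap (fmap f) t))
                (cong (str RFY) (trans (sym (fmap-∘ (str RFY) (fmap f) t))
                  refl))) }
    where RFY = MonadEM.R₀ R (Free Y)

module Powers {o : Level} (𝕋 : MonadSet) (𝒟 : Category o) (cpl : Complete 𝒟) where
  open MonadSet 𝕋
  open Category 𝒟
  open Complete cpl

  infix 10 _^_
  _^_ : Obj → Set → Obj
  A ^ X = Product.Π (product {X} (λ _ → A))

  π : ∀ {A X} → X → Hom (A ^ X) A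
  π {A} {X} x = Product.π (product {X} (λ _ → A)) x

  ⟨_⟩ : ∀ {A X D} → (X → Hom D A) → Hom D (A ^ X)
  ⟨_⟩ {A} {X} f = Product.⟨_⟩ (product {X} (λ _ → A)) f

  π-⟨⟩ : ∀ {A X D} (f : X → Hom D A) (x : X) → π x ∘ ⟨ f ⟩ ≡ f x
  π-⟨⟩ {A} {X} f x = Product.π-⟨⟩ (product {X} (λ _ → A)) f x

  ^-ext : ∀ {A X D} (g h : Hom D (A ^ X)) → ((x : X) → π x ∘ g ≡ π x ∘ h) → g ≡ h
  ^-ext {A} {X} g h p =
    trans (Product.⟨⟩-unique P (λ x → π x ∘ h) g p)
          (sym (Product.⟨⟩-unique P (λ x → π x ∘ h) h (λ _ → refl)))
    where P = product {X} (λ _ → A)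

  _* : ∀ {A X Y} → (X → Y) → Hom (A ^ Y) (A ^ X)
  g * = ⟨ (λ x → π (g x)) ⟩

  record RelAlg (A : Obj) : Set₁ where
    field
      α     : ∀ {X} → T X → Hom (A ^ X) A
      α-nat : ∀ {X Y} (g : X → Y) (t : T X) → α (fmap g t) ≡ α t ∘ _* {A} g
      α-η   : ∀ {X} (x : X) → α (η x) ≡ π x
      α-μ   : ∀ {X} (t : T (T X)) →
              α (μ t) ≡ α (fmap (α {X}) t) ∘ ⟨ (λ (φ : Hom (A ^ X) A) → φ) ⟩

module Dual {o : Level} (𝕋 : MonadSet) (𝒟 : Category o) (cpl : Complete 𝒟)
            (Ω : Category.Obj 𝒟) (τ : Powers.RelAlg 𝕋 𝒟 cpl Ω) where
  open MonadSet 𝕋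
  open Category 𝒟
  open Powers 𝕋 𝒟 cpl
  open RelAlg τ
  open EM 𝕋
  open ≡-Reasoning

  _⋆ : ∀ {X Y : Set} → (X → Y) → Hom (Ω ^ Y) (Ω ^ X)
  g ⋆ = _* {Ω} g

  π-⋆ : ∀ {X Y : Set} (g : X → Y) (x : X) → π x ∘ g ⋆ ≡ π (g x)
  π-⋆ g x = π-⟨⟩ (λ x → π (g x)) x

  -- id^♯ = ⟨ k ⟩_k : D → Ω^{D(D,Ω)}
  ids : (D : Obj) → Hom D (Ω ^ Hom D Ω)
  ids D = ⟨ (λ (k : Hom D Ω) → k) ⟩

  π-ids : ∀ {D} (k : Hom D Ω) → π k ∘ ids D ≡ k
  π-ids {D} k = π-⟨⟩ (λ (k : Hom D Ω) → k) k

  pre : ∀ {A B C E} (p : Hom B C) (g : Hom A B) (h : Hom E A) →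
        p ∘ (g ∘ h) ≡ (p ∘ g) ∘ h
  pre p g h = sym assoc

  [_]D : Obj → Alg
  [ D ]D = record
    { Car = Hom D Ω
    ; str = λ t → α t ∘ ids D
    ; str-η = λ k → trans (cong (_∘ ids D) (α-η k)) (π-ids k)
    ; str-μ = λ t →
        begin
          α (μ t) ∘ ids D
        ≡⟨ cong (_∘ ids D) (α-μ t) ⟩
          (α (fmap α t) ∘ ⟨ (λ φ → φ) ⟩) ∘ ids D
        ≡⟨ assoc ⟩
          α (fmap α t) ∘ (⟨ (λ φ → φ) ⟩ ∘ ids D)
        ≡⟨ cong (α (fmap α t) ∘_) (sym lem) ⟩
          α (fmap α t) ∘ (g ⋆ ∘ ids D)
        ≡⟨ sym assoc ⟩
          (α (fmap α t) ∘ g ⋆) ∘ ids D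
        ≡⟨ cong (_∘ ids D) (sym (α-nat g (fmap α t))) ⟩
          α (fmap g (fmap α t)) ∘ ids D
        ≡⟨ cong (λ u → α u ∘ ids D) (sym (fmap-∘ g α t)) ⟩
          α (fmap (λ s → α s ∘ ids D) t) ∘ ids D
        ∎ }
    where
    g : Hom (Ω ^ Hom D Ω) Ω → Hom D Ω
    g φ = φ ∘ ids D
    lem : g ⋆ ∘ ids D ≡ ⟨ (λ φ → φ) ⟩ ∘ ids D
    lem = ^-ext _ _ λ φ →
      trans (pre (π φ) (g ⋆) (ids D))
      (trans (cong (_∘ ids D) (π-⋆ g φ))
      (trans (π-ids (g φ))
      (sym (trans (pre (π φ) ⟨ (λ φ → φ) ⟩ (ids D))
                  (cong (_∘ ids D) (π-⟨⟩ (λ φ → φ) φ))))))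

  [_]D₁ : ∀ {D D′} → Hom D D′ → AlgHom [ D′ ]D [ D ]D
  [_]D₁ {D} {D′} g = record
    { fun = λ k → k ∘ g
    ; hom = λ t →
        trans assoc
        (trans (cong (α t ∘_) lem)
        (trans (sym assoc)
               (cong (_∘ ids D) (sym (α-nat (λ k → k ∘ g) t))))) }
    where
    lem : ids D′ ∘ g ≡ (λ (k : Hom D′ Ω) → k ∘ g) ⋆ ∘ ids D
    lem = ^-ext _ _ λ k →
      trans (pre (π k) (ids D′) g)
      (trans (cong (_∘ g) (π-ids k))
      (sym (trans (pre (π k) _ (ids D))
           (trans (cong (_∘ ids D) (π-⋆ (λ (k : Hom D′ Ω) → k ∘ g) k))
                  (π-ids (k ∘ g))))))

  τ♯ : (X : Set) → Hom (Ω ^ X) (Ω ^ T X)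
  τ♯ X = ⟨ (λ (t : T X) → α t) ⟩

  equalizes : ∀ {E} (A : Alg) (h : Hom E (Ω ^ Car A)) →
              (∀ t → π (str A t) ∘ h ≡ α t ∘ h) →
              str A ⋆ ∘ h ≡ τ♯ (Car A) ∘ h
  equalizes A h p = ^-ext _ _ λ t →
    trans (pre (π t) (str A ⋆) h)
    (trans (cong (_∘ h) (π-⋆ (str A) t))
    (trans (p t)
    (sym (trans (pre (π t) (τ♯ (Car A)) h)
               (cong (_∘ h) (π-⟨⟩ (λ t → α t) t))))))

  EqT : (A : Alg) → Equalizer 𝒟 (str A ⋆) (τ♯ (Car A))
  EqT A = Complete.equalizer cpl (str A ⋆) (τ♯ (Car A))

  [_]T : Alg → Obj
  [ A ]T = Equalizer.E (EqT A)

  eT : (A : Alg) → Hom [ A ]T (Ω ^ Car A)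
  eT A = Equalizer.e (EqT A)

  eq-comp : (A : Alg) (t : T (Car A)) → π (str A t) ∘ eT A ≡ α t ∘ eT A
  eq-comp A t =
    begin
      π (str A t) ∘ eT A
    ≡⟨ cong (_∘ eT A) (sym (π-⋆ (str A) t)) ⟩
      (π t ∘ str A ⋆) ∘ eT A
    ≡⟨ assoc ⟩
      π t ∘ (str A ⋆ ∘ eT A)
    ≡⟨ cong (π t ∘_) (Equalizer.e-eq (EqT A)) ⟩
      π t ∘ (τ♯ (Car A) ∘ eT A)
    ≡⟨ sym assoc ⟩
      (π t ∘ τ♯ (Car A)) ∘ eT A
    ≡⟨ cong (_∘ eT A) (π-⟨⟩ (λ t → α t) t) ⟩
      α t ∘ eT A
    ∎

  [_]T₁ : ∀ {A B} → AlgHom A B → Hom [ B ]T [ A ]T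
  [_]T₁ {A} {B} f = Equalizer.lift (EqT A) (fun f ⋆ ∘ eT B)
    (equalizes A (fun f ⋆ ∘ eT B) λ t →
      begin
        π (str A t) ∘ (fun f ⋆ ∘ eT B)
      ≡⟨ sym assoc ⟩
        (π (str A t) ∘ fun f ⋆) ∘ eT B
      ≡⟨ cong (_∘ eT B) (π-⋆ (fun f) (str A t)) ⟩
        π (fun f (str A t)) ∘ eT B
      ≡⟨ cong (λ u → π u ∘ eT B) (hom f t) ⟩
        π (str B (fmap (fun f) t)) ∘ eT B
      ≡⟨ eq-comp B (fmap (fun f) t) ⟩
        α (fmap (fun f) t) ∘ eT B
      ≡⟨ cong (_∘ eT B) (α-nat (fun f) t) ⟩
        (α t ∘ fun f ⋆) ∘ eT B
      ≡⟨ assoc ⟩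
        α t ∘ (fun f ⋆ ∘ eT B)
      ∎)

  transpose : ∀ {A D} → AlgHom A [ D ]D → Hom D [ A ]T
  transpose {A} {D} h = Equalizer.lift (EqT A) ⟨ fun h ⟩
    (equalizes A ⟨ fun h ⟩ λ t →
      begin
        π (str A t) ∘ ⟨ fun h ⟩
      ≡⟨ π-⟨⟩ (fun h) (str A t) ⟩
        fun h (str A t)
      ≡⟨ hom h t ⟩
        α (fmap (fun h) t) ∘ ids D
      ≡⟨ cong (_∘ ids D) (α-nat (fun h) t) ⟩
        (α t ∘ fun h ⋆) ∘ ids D
      ≡⟨ assoc ⟩
        α t ∘ (fun h ⋆ ∘ ids D)
      ≡⟨ cong (α t ∘_) lem ⟩
        α t ∘ ⟨ fun h ⟩
      ∎)
    where
    lem : fun h ⋆ ∘ ids D ≡ ⟨ fun h ⟩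
    lem = ^-ext _ _ λ a →
      trans (pre (π a) (fun h ⋆) (ids D))
      (trans (cong (_∘ ids D) (π-⋆ (fun h) a))
      (trans (π-ids (fun h a)) (sym (π-⟨⟩ (fun h) a))))

  S₀ : Alg → Alg
  S₀ A = [ [ A ]T ]D

  S₁ : ∀ {A B} → AlgHom A B → AlgHom (S₀ A) (S₀ B)
  S₁ f = [ [ f ]T₁ ]D₁

  ηS : (A : Alg) → AlgHom A (S₀ A)
  ηS A = record
    { fun = g
    ; hom = λ t →
        begin
          π (str A t) ∘ eT A
        ≡⟨ eq-comp A t ⟩
          α t ∘ eT A
        ≡⟨ cong (α t ∘_) (sym lem) ⟩
          α t ∘ (g ⋆ ∘ ids [ A ]T)
        ≡⟨ sym assoc ⟩
          (α t ∘ g ⋆) ∘ ids [ A ]T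
        ≡⟨ cong (_∘ ids [ A ]T) (sym (α-nat g t)) ⟩
          α (fmap g t) ∘ ids [ A ]T
        ∎ }
    where
    g : Car A → Hom [ A ]T Ω
    g a = π a ∘ eT A
    lem : g ⋆ ∘ ids [ A ]T ≡ eT A
    lem = ^-ext _ _ λ a →
      trans (pre (π a) (g ⋆) (ids [ A ]T))
      (trans (cong (_∘ ids [ A ]T) (π-⋆ g a)) (π-ids (g a)))

  -- counit (as a 𝒟-morphism D → [[D,Ω̄]_D , Ω̄]_T): transpose of the identity
  εS : (D : Obj) → Hom D [ [ D ]D ]T
  εS D = transpose (idₕ {[ D ]D})

  μS : (A : Alg) → AlgHom (S₀ (S₀ A)) (S₀ A)
  μS A = [ εS [ A ]T ]D₁

  record MonadMap (R : MonadEM) : Set₁ where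
    open MonadEM R
    field
      ρ     : (A : Alg) → AlgHom (R₀ A) (S₀ A)
      ρ-nat : ∀ {A B} (f : AlgHom A B) → ρ B ∘ₕ R₁ f ≈ₕ S₁ f ∘ₕ ρ A
      ρ-η   : (A : Alg) → ρ A ∘ₕ ηᴿ A ≈ₕ ηS A
      ρ-μ   : (A : Alg) → ρ A ∘ₕ μᴿ A ≈ₕ μS A ∘ₕ (S₁ (ρ A) ∘ₕ ρ (R₀ A))

  -- canonical isomorphism [F Z , Ω̄]_T ≅ Ω^Z, both directions
  φ : (Z : Set) → Hom (Ω ^ Z) [ Free Z ]T
  φ Z = Equalizer.lift (EqT (Free Z)) (τ♯ Z)
    (equalizes (Free Z) (τ♯ Z) λ t →
      begin
        π (μ t) ∘ τ♯ Z
      ≡⟨ π-⟨⟩ (λ t → α t) (μ t) ⟩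
        α (μ t)
      ≡⟨ α-μ t ⟩
        α (fmap α t) ∘ ⟨ (λ φ → φ) ⟩
      ≡⟨ cong (_∘ ⟨ (λ φ → φ) ⟩) (α-nat α t) ⟩
        (α t ∘ α ⋆) ∘ ⟨ (λ φ → φ) ⟩
      ≡⟨ assoc ⟩
        α t ∘ (α ⋆ ∘ ⟨ (λ φ → φ) ⟩)
      ≡⟨ cong (α t ∘_) lem ⟩
        α t ∘ τ♯ Z
      ∎)
    where
    lem : α ⋆ ∘ ⟨ (λ (φ : Hom (Ω ^ Z) Ω) → φ) ⟩ ≡ τ♯ Z
    lem = ^-ext _ _ λ s →
      trans (pre (π s) (α ⋆) _)
      (trans (cong (_∘ ⟨ (λ φ → φ) ⟩) (π-⋆ α s))
      (trans (π-⟨⟩ (λ φ → φ) (α s)) (sym (π-⟨⟩ (λ t → α t) s))))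

  ψ : (Z : Set) → Hom [ Free Z ]T (Ω ^ Z)
  ψ Z = η ⋆ ∘ eT (Free Z)

  module _ (R : MonadEM) (ρm : MonadMap R) where
    open MonadEM R
    open MonadMap ρm

    ρ♯ : (B : Alg) → Hom [ B ]T [ R₀ B ]T
    ρ♯ B = transpose (ρ B)

    Pρ : ∀ {A B} → AlgHom A (R₀ B) → Hom [ B ]T [ A ]T
    Pρ {A} {B} f = [ f ]T₁ ∘ ρ♯ B

    -- P^(τ,ρ)_{XY} : Set(X , U R F Y) → 𝒟(Ω^Y , Ω^X), transported along
    -- the isomorphisms [F Z,Ω̄]_T ≅ Ω^Z
    Pτρ : (X Y : Set) → (X → Car (R₀ (Free Y))) → Hom (Ω ^ Y) (Ω ^ X)
    Pτρ X Y f = ψ X ∘ (Pρ (K R f) ∘ φ Y)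

    -- U ρ_{FY} : U R F Y → U [[F Y,Ω̄]_T,Ω̄]_D ≅ 𝒟(Ω^Y , Ω)
    Uρ : (Y : Set) → Car (R₀ (Free Y)) → Hom (Ω ^ Y) Ω
    Uρ Y u = fun (ρ (Free Y)) u ∘ φ Y

module Submission where

-- Proof idea.  Under the isomorphisms [F Z, Ω̄]_T ≅ Ω^Z, the action of
-- P^(τ,ρ) on a function f : X → U R F Y is the tuple
--
--     P^(τ,ρ)(f) = ⟨ Uρ_Y (f x) ⟩_{x ∈ X} : Ω^Y → Ω^X ,
--
-- i.e. its x-th component is U ρ_{FY} applied to f x.  Since tupling
-- X → 𝒟(D, A) ≅ 𝒟(D, A^X) is a bijection, post-composition with a
-- surjective (resp. injective) map of components yields a surjective
-- (resp. injective) map into 𝒟(Ω^Y, Ω^X).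

open import Defs
open import Level using (Level)
open import Data.Product using (_×_; _,_; proj₁; proj₂)
open import Relation.Binary.PropositionalEquality

module PowerFacts {o : Level} (𝕋 : MonadSet) (𝒟 : Category o) (cpl : Complete 𝒟) where
  open Category 𝒟
  open Powers 𝕋 𝒟 cpl

  ⟨⟩-cong : ∀ {A X D} {h h′ : X → Hom D A} →
            (∀ x → h x ≡ h′ x) → ⟨ h ⟩ ≡ ⟨ h′ ⟩
  ⟨⟩-cong {h = h} {h′} p =
    ^-ext _ _ λ x → trans (π-⟨⟩ h x) (trans (p x) (sym (π-⟨⟩ h′ x)))

  ⟨⟩-∘ : ∀ {A X D E} (h : X → Hom D A) (k : Hom E D) →
         ⟨ h ⟩ ∘ k ≡ ⟨ (λ x → h x ∘ k) ⟩
  ⟨⟩-∘ h k = ^-ext _ _ λ x →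
    trans (sym assoc) (trans (cong (_∘ k) (π-⟨⟩ h x)) (sym (π-⟨⟩ _ x)))

  *-⟨⟩ : ∀ {A X Y D} (g : X → Y) (h : Y → Hom D A) →
         _* {A} g ∘ ⟨ h ⟩ ≡ ⟨ (λ x → h (g x)) ⟩
  *-⟨⟩ g h = trans (⟨⟩-∘ (λ x → π (g x)) ⟨ h ⟩) (⟨⟩-cong (λ x → π-⟨⟩ h (g x)))

  module _ {A D : Obj} {X E : Set} (u : E → Hom D A) (P : (X → E) → Hom D (A ^ X))
           (P-tuple : ∀ f → P f ≡ ⟨ (λ x → u (f x)) ⟩) where

    tuple-surjective : Surjective u → Surjective P
    tuple-surjective u-surj h = f , ^-ext _ _ component
      where
      f : X → E
      f x = proj₁ (u-surj (π x ∘ h))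
      component : ∀ x → π x ∘ P f ≡ π x ∘ h
      component x = trans (cong (π x ∘_) (P-tuple f))
                          (trans (π-⟨⟩ _ x) (proj₂ (u-surj (π x ∘ h))))

    tuple-injective : Injective _≡_ u → Injective _≐_ P
    tuple-injective u-inj f g Pf≡Pg x = u-inj (f x) (g x) (begin
        u (f x)                        ≡⟨ sym (π-⟨⟩ _ x) ⟩
        π x ∘ ⟨ (λ x → u (f x)) ⟩      ≡⟨ cong (π x ∘_) (sym (P-tuple f)) ⟩
        π x ∘ P f                      ≡⟨ cong (π x ∘_) Pf≡Pg ⟩
        π x ∘ P g                      ≡⟨ cong (π x ∘_) (P-tuple g) ⟩
        π x ∘ ⟨ (λ x → u (g x)) ⟩      ≡⟨ π-⟨⟩ _ x ⟩
        u (g x)                        ∎)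
      where open ≡-Reasoning

module TupleFormula {o : Level} (𝕋 : MonadSet) (𝒟 : Category o) (cpl : Complete 𝒟)
    (Ω : Category.Obj 𝒟) (τ : Powers.RelAlg 𝕋 𝒟 cpl Ω)
    (R : EM.MonadEM 𝕋) (ρm : Dual.MonadMap 𝕋 𝒟 cpl Ω τ R) where
  open MonadSet 𝕋
  open Category 𝒟
  open Powers 𝕋 𝒟 cpl
  open PowerFacts 𝕋 𝒟 cpl
  open EM 𝕋
  open Dual 𝕋 𝒟 cpl Ω τ
  open MonadEM R
  open MonadMap ρm
  open ≡-Reasoning

  eT-[]T₁ : ∀ {A B} (f : AlgHom A B) → eT A ∘ [ f ]T₁ ≡ fun f ⋆ ∘ eT B
  eT-[]T₁ {A} _ = Equalizer.e-lift (EqT A) _ _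

  eT-transpose : ∀ {A D} (h : AlgHom A [ D ]D) → eT A ∘ transpose h ≡ ⟨ fun h ⟩
  eT-transpose {A} _ = Equalizer.e-lift (EqT A) _ _

  ψ-[]T₁ : ∀ {X B} (g : AlgHom (Free X) B) →
           ψ X ∘ [ g ]T₁ ≡ (λ x → fun g (η x)) ⋆ ∘ eT B
  ψ-[]T₁ {X} {B} g = begin
      (η ⋆ ∘ eT (Free X)) ∘ [ g ]T₁
    ≡⟨ assoc ⟩
      η ⋆ ∘ (eT (Free X) ∘ [ g ]T₁)
    ≡⟨ cong (η ⋆ ∘_) (eT-[]T₁ g) ⟩
      η ⋆ ∘ (fun g ⋆ ∘ eT B)
    ≡⟨ sym assoc ⟩
      (η ⋆ ∘ fun g ⋆) ∘ eT B
    ≡⟨ cong (_∘ eT B) (*-⟨⟩ η (λ b → π (fun g b))) ⟩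
      (λ x → fun g (η x)) ⋆ ∘ eT B
    ∎

  ψ-Pρ : ∀ {X B} (g : AlgHom (Free X) (R₀ B)) →
         ψ X ∘ Pρ R ρm g ≡ ⟨ (λ x → fun (ρ B) (fun g (η x))) ⟩
  ψ-Pρ {X} {B} g = begin
      ψ X ∘ ([ g ]T₁ ∘ ρ♯ R ρm B)
    ≡⟨ sym assoc ⟩
      (ψ X ∘ [ g ]T₁) ∘ ρ♯ R ρm B
    ≡⟨ cong (_∘ ρ♯ R ρm B) (ψ-[]T₁ g) ⟩
      (gη ⋆ ∘ eT (R₀ B)) ∘ ρ♯ R ρm B
    ≡⟨ assoc ⟩
      gη ⋆ ∘ (eT (R₀ B) ∘ ρ♯ R ρm B)
    ≡⟨ cong (gη ⋆ ∘_) (eT-transpose (ρ B)) ⟩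
      gη ⋆ ∘ ⟨ fun (ρ B) ⟩
    ≡⟨ *-⟨⟩ gη (fun (ρ B)) ⟩
      ⟨ (λ x → fun (ρ B) (gη x)) ⟩
    ∎
    where
    gη : X → Car (R₀ B)
    gη x = fun g (η x)

  K-η : ∀ {X Y} (f : X → Car (R₀ (Free Y))) (x : X) → fun (K R f) (η x) ≡ f x
  K-η {Y = Y} f x =
    trans (cong (str (R₀ (Free Y))) (η-nat f x)) (str-η (R₀ (Free Y)) (f x))

  Pτρ-tuple : ∀ X Y (f : X → Car (R₀ (Free Y))) →
              Pτρ R ρm X Y f ≡ ⟨ (λ x → Uρ R ρm Y (f x)) ⟩
  Pτρ-tuple X Y f = begin
      ψ X ∘ (Pρ R ρm (K R f) ∘ φ Y)
    ≡⟨ sym assoc ⟩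
      (ψ X ∘ Pρ R ρm (K R f)) ∘ φ Y
    ≡⟨ cong (_∘ φ Y) (ψ-Pρ (K R f)) ⟩
      ⟨ (λ x → fun ρFY (fun (K R f) (η x))) ⟩ ∘ φ Y
    ≡⟨ cong (_∘ φ Y) (⟨⟩-cong λ x → cong (fun ρFY) (K-η f x)) ⟩
      ⟨ (λ x → fun ρFY (f x)) ⟩ ∘ φ Y
    ≡⟨ ⟨⟩-∘ (λ x → fun ρFY (f x)) (φ Y) ⟩
      ⟨ (λ x → Uρ R ρm Y (f x)) ⟩
    ∎
    where
    ρFY : AlgHom (R₀ (Free Y)) (S₀ (Free Y))
    ρFY = ρ (Free Y)

theorem6p5 : {o : Level} (𝕋 : MonadSet) (𝒟 : Category o) (cpl : Complete 𝒟)
    (Ω : Category.Obj 𝒟) (τ : Powers.RelAlg 𝕋 𝒟 cpl Ω)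
    (R : EM.MonadEM 𝕋) (ρ : Dual.MonadMap 𝕋 𝒟 cpl Ω τ R) (X Y : Set) →
    (Surjective (Dual.Uρ 𝕋 𝒟 cpl Ω τ R ρ Y) →
    Surjective (Dual.Pτρ 𝕋 𝒟 cpl Ω τ R ρ X Y))
    × (Injective _≡_ (Dual.Uρ 𝕋 𝒟 cpl Ω τ R ρ Y) →
    Injective _≐_ (Dual.Pτρ 𝕋 𝒟 cpl Ω τ R ρ X Y))
theorem6p5 𝕋 𝒟 cpl Ω τ R ρ X Y =
  tuple-surjective (Uρ R ρ Y) (Pτρ R ρ X Y) (Pτρ-tuple X Y) ,
  tuple-injective (Uρ R ρ Y) (Pτρ R ρ X Y) (Pτρ-tuple X Y)
  where
  open PowerFacts 𝕋 𝒟 cpl using (tuple-surjective; tuple-injective)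
  open Dual 𝕋 𝒟 cpl Ω τ using (Uρ; Pτρ)
  open TupleFormula 𝕋 𝒟 cpl Ω τ R ρ using (Pτρ-tuple)
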